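{- Fix positive integers $r,s$, integers $x\le 0\le y$, and a state $\sigma\in\Sigma(x,y)$ of the one-dimensional generalized rotor-router model described in the context. Let $0>u_1>\dots>u_m$ be the sites to the left of the origin labeled $R$, and $0<v_1<\dots<v_n$ the sites to the right of the origin labeled $L$; set $u_0=v_0=0$, $u_{m+1}=x-1$, $v_{n+1}=y+1$. If $\sigma(0)=L$, then the path of the particle added at the origin travels directly left from the origin to $u_1$, then directly right to $v_1$, directly left to $u_2$, directly right to $v_2$, and so on, until it reaches either $u_{m+1}$ or $v_{n+1}$, at which point it stops. If $\sigma(0)=R$, the same holds with left and right interchanged and the roles of the $u_i$ and $v_i$ interchanged (it travels right to $v_1$, left to $u_1$, right to $v_2$, \dots). In particular, if $m<n$ the path terminates at $u_{m+1}$; if $m>n$ it terminates at $v_{n+1}$; and if $m=n$ it terminates at $u_{m+1}$ or $v_{n+1}$ according as $\sigma(0)=L$ or $\sigma(0)=R$.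
   Context: For integers $a\le b$, $[a,b]=\{k\in\mathbb{Z}: a\le k\le b\}$. Fix positive integers $r,s$. A state consists of integers $x\le 0\le y$ (the occupied interval $[x,y]$) and a labeling $\sigma:[x,y]\to\{L,R\}$; $\Sigma(x,y)$ is the set of such states. A particle is added at site $0$; whenever it is at an occupied site $k$ it moves to $k-1$ if the label at $k$ is $L$ and to $k+1$ if it is $R$, and the label at $k$ is then switched ($L\leftrightarrow R$); the path stops when the particle first reaches an unoccupied site (then $r$ sites $[x-r,x-1]$, resp. $s$ sites $[y+1,y+s]$, become occupied with label $R$, according as the unoccupied site reached is $x-1$ or $y+1$). The path of the particle is the sequence of sites it visits. -}

module Defs where

open import Data.Nat using (ℕ; zero; suc)
open import Data.Integer using (ℤ; +_; -[1+_]; _+_; _-_; -_; ∣_∣; _≤_; _<_)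
import Data.Integer as ℤ
open import Data.List using (List; []; _∷_; _++_; map; filter; upTo)
open import Data.Bool using (if_then_else_)
open import Data.Sum using (_⊎_)
open import Relation.Nullary using (Dec; yes; no; does)
open import Relation.Binary.PropositionalEquality using (_≡_; refl)

data Label : Set where
  L R : Label

_≟L_ : (a b : Label) → Dec (a ≡ b)
L ≟L L = yes refl
L ≟L R = no (λ ())
R ≟L L = no (λ ())
R ≟L R = yes refl

switch : Label → Label
switch L = R
switch R = L

-- A labeling of sites; only its restriction to the occupied interval [x,y]
-- is relevant (a state of Σ(x,y)).
Labeling : Set
Labeling = ℤ → Label

switchAt : Labeling → ℤ → Labeling
switchAt σ k j = if does (j ℤ.≟ k) then switch (σ j) else σ j

-- RunPath x y σ k p : starting at site k with labeling σ on the occupied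
-- interval [x,y], the particle visits exactly the sequence of sites p
-- (including k and the final unoccupied site where it stops).
data RunPath (x y : ℤ) : Labeling → ℤ → List ℤ → Set where
  stop  : ∀ {σ k} → (k < x ⊎ y < k) → RunPath x y σ k (k ∷ [])
  moveL : ∀ {σ k p} → x ≤ k → k ≤ y → σ k ≡ L →
          RunPath x y (switchAt σ k) (k - + 1) p → RunPath x y σ k (k ∷ p)
  moveR : ∀ {σ k p} → x ≤ k → k ≤ y → σ k ≡ R →
          RunPath x y (switchAt σ k) (k + + 1) p → RunPath x y σ k (k ∷ p)

leftRs : ℤ → Labeling → List ℤ
leftRs x σ = filter (λ k → σ k ≟L R) (map (λ i → -[1+ i ]) (upTo ∣ x ∣))

rightLs : ℤ → Labeling → List ℤ
rightLs y σ = filter (λ k → σ k ≟L L) (map (λ i → + suc i) (upTo ∣ y ∣))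

walkL : ℤ → ℕ → List ℤ
walkL a zero = []
walkL a (suc k) = (a - + 1) ∷ walkL (a - + 1) k

walkR : ℤ → ℕ → List ℤ
walkR a zero = []
walkR a (suc k) = (a + + 1) ∷ walkR (a + + 1) k

-- Zigzag from the current position p: go directly left to the next u
-- (zigL) or directly right to the next v (zigR), alternating, and stop
-- once the last element (u_{m+1} = x-1, resp. v_{n+1} = y+1) is reached.
mutual
  zigL : ℤ → List ℤ → List ℤ → List ℤ
  zigL p [] vs = []
  zigL p (u ∷ []) vs = walkL p ∣ p - u ∣
  zigL p (u ∷ us@(_ ∷ _)) vs = walkL p ∣ p - u ∣ ++ zigR u us vs

  zigR : ℤ → List ℤ → List ℤ → List ℤ
  zigR p us [] = []
  zigR p us (v ∷ []) = walkR p ∣ v - p ∣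
  zigR p us (v ∷ vs@(_ ∷ _)) = walkR p ∣ v - p ∣ ++ zigL v us vs

zigzagPath : ℤ → ℤ → Labeling → List ℤ
zigzagPath x y σ with σ (+ 0)
... | L = + 0 ∷ zigL (+ 0) (leftRs x σ ++ (x - + 1) ∷ []) (rightLs y σ ++ (y + + 1) ∷ [])
... | R = + 0 ∷ zigR (+ 0) (leftRs x σ ++ (x - + 1) ∷ []) (rightLs y σ ++ (y + + 1) ∷ [])

-- Every leg of the path walks through sites that point the way it is going and flips them,
-- so the swept interval [a, b] always carries a single label (the current direction) while
-- every site outside it still carries its initial label. A leftward leg therefore crosses the
-- swept interval and then the L-sites below it, and turns exactly at the first site labelled
-- R (the next uᵢ), or falls off at x - 1; symmetrically for rightward legs. Which end the
-- particle falls off is then decided by counting the uᵢ against the vⱼ.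
module Submission where

open import Data.Nat using (ℕ; zero; suc)
import Data.Nat as ℕ
import Data.Nat.Properties as ℕ
open import Data.Integer using (ℤ; +_; -[1+_]; _+_; _-_; ∣_∣; _≤_; _<_; -1ℤ)
import Data.Integer as ℤ
open import Data.Integer.Properties
open import Data.Integer.Tactic.RingSolver using (solve-∀)
open import Data.List using (List; []; _∷_; _++_; [_]; _∷ʳ_; filter; applyUpTo; length; last)
open import Data.List.Properties using (++-identityʳ; map-upTo)
open import Data.Maybe using (Maybe; just; nothing)
open import Data.Product using (_×_; _,_; proj₁; proj₂)
open import Data.Sum using (_⊎_; inj₁; inj₂)
open import Data.Empty using (⊥-elim)
open import Function using (_∘_)
open import Relation.Nullary using (yes; no; ¬_)
open import Relation.Binary.PropositionalEquality hiding ([_])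

open import Defs

i-1<i : ∀ i → i - + 1 < i
i-1<i i = i≤pred[j]⇒i<j (≤-reflexive (+-comm i -1ℤ))

<⇒≤-1 : ∀ {i j} → i < j → i ≤ j - + 1
<⇒≤-1 {i} {j} i<j = subst (i ≤_) (+-comm -1ℤ j) (i<j⇒i≤pred[j] i<j)

i<i+1 : ∀ i → i < i + + 1
i<i+1 i = suc[i]≤j⇒i<j (≤-reflexive (+-comm (+ 1) i))

<+1⇒≤ : ∀ {i j} → i < j + + 1 → i ≤ j
<+1⇒≤ {i} {j} i<j+1 = subst (i ≤_) (lemma j) (<⇒≤-1 i<j+1)
  where
  lemma : ∀ j → j + + 1 - + 1 ≡ j
  lemma = solve-∀

<⇒+1≤ : ∀ {i j} → i < j → i + + 1 ≤ j
<⇒+1≤ {i} {j} i<j = subst (_≤ j) (+-comm (+ 1) i) (i<j⇒suc[i]≤j i<j)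

-1<⇒≤ : ∀ {i j} → i - + 1 < j → i ≤ j
-1<⇒≤ {i} {j} i-1<j = subst (_≤ j) (lemma i) (i<j⇒suc[i]≤j i-1<j)
  where
  lemma : ∀ i → + 1 + (i - + 1) ≡ i
  lemma = solve-∀

i-suc[n]≡i-1-n : ∀ i n → i - + suc n ≡ i - + 1 - + n
i-suc[n]≡i-1-n i n = lemma i (+ n)
  where
  lemma : ∀ i m → i - (+ 1 + m) ≡ i - + 1 - m
  lemma = solve-∀

i+suc[n]≡i+1+n : ∀ i n → i + + suc n ≡ i + + 1 + + n
i+suc[n]≡i+1+n i n = lemma i (+ n)
  where
  lemma : ∀ i m → i + (+ 1 + m) ≡ i + + 1 + m
  lemma = solve-∀

j≤i⇒i-∣i-j∣≡j : ∀ {i j} → j ≤ i → i - + ∣ i - j ∣ ≡ j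
j≤i⇒i-∣i-j∣≡j {i} {j} j≤i = trans (cong (λ m → i - m) (0≤i⇒+∣i∣≡i (i≤j⇒0≤j-i j≤i))) (lemma i j)
  where
  lemma : ∀ i j → i - (i - j) ≡ j
  lemma = solve-∀

i≤j⇒i+∣j-i∣≡j : ∀ {i j} → i ≤ j → i + + ∣ j - i ∣ ≡ j
i≤j⇒i+∣j-i∣≡j {i} {j} i≤j = trans (cong (λ m → i + m) (0≤i⇒+∣i∣≡i (i≤j⇒0≤j-i i≤j))) (lemma i j)
  where
  lemma : ∀ i j → i + (j - i) ≡ j
  lemma = solve-∀

i≤0⇒0-∣i∣≡i : ∀ {i} → i ≤ + 0 → + 0 - + ∣ i ∣ ≡ i
i≤0⇒0-∣i∣≡i {+ zero} _ = refl
i≤0⇒0-∣i∣≡i { -[1+ n ]} _ = refl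
i≤0⇒0-∣i∣≡i {+ suc n} (ℤ.+≤+ ())

0≤i⇒0+∣i∣≡i : ∀ {i} → + 0 ≤ i → + 0 + + ∣ i ∣ ≡ i
0≤i⇒0+∣i∣≡i {+ n} _ = refl

≤⊎> : ∀ i j → i ≤ j ⊎ j < i
≤⊎> i j with i ≤? j
... | yes i≤j = inj₁ i≤j
... | no i≰j = inj₂ (≰⇒> i≰j)

≢R⇒≡L : ∀ {ℓ} → ¬ ℓ ≡ R → ℓ ≡ L
≢R⇒≡L {L} _ = refl
≢R⇒≡L {R} ℓ≢R = ⊥-elim (ℓ≢R refl)

≢L⇒≡R : ∀ {ℓ} → ¬ ℓ ≡ L → ℓ ≡ R
≢L⇒≡R {R} _ = refl
≢L⇒≡R {L} ℓ≢L = ⊥-elim (ℓ≢L refl)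

switchAt-self : ∀ τ k → switchAt τ k k ≡ switch (τ k)
switchAt-self τ k with k ℤ.≟ k
... | yes _ = refl
... | no k≢k = ⊥-elim (k≢k refl)

switchAt-other : ∀ τ {k j} → j ≢ k → switchAt τ k j ≡ τ j
switchAt-other τ {k} {j} j≢k with j ℤ.≟ k
... | yes j≡k = ⊥-elim (j≢k j≡k)
... | no _ = refl

last-++ : ∀ {A : Set} (a : A) {c} w t → last (a ∷ w) ≡ just c → last (a ∷ w ++ t) ≡ last (c ∷ t)
last-++ a [] t refl = refl
last-++ a (b ∷ w) t last≡ = last-++ b w t last≡

last-walkL : ∀ k n → last (k ∷ walkL k n) ≡ just (k - + n)
last-walkL k zero = cong just (sym (+-identityʳ k))
last-walkL k (suc n) = trans (last-walkL (k - + 1) n) (cong just (sym (i-suc[n]≡i-1-n k n)))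

last-walkR : ∀ k n → last (k ∷ walkR k n) ≡ just (k + + n)
last-walkR k zero = cong just (sym (+-identityʳ k))
last-walkR k (suc n) = trans (last-walkR (k + + 1) n) (cong just (sym (i+suc[n]≡i+1+n k n)))

mutual
  zigEndL : List ℤ → List ℤ → Maybe ℤ
  zigEndL [] vs = nothing
  zigEndL (u ∷ []) vs = just u
  zigEndL (u ∷ us@(_ ∷ _)) vs = zigEndR us vs

  zigEndR : List ℤ → List ℤ → Maybe ℤ
  zigEndR us [] = nothing
  zigEndR us (v ∷ []) = just v
  zigEndR us (v ∷ vs@(_ ∷ _)) = zigEndL us vs

zigEndL-∷ : ∀ u us p vs → zigEndL (u ∷ us ∷ʳ p) vs ≡ zigEndR (us ∷ʳ p) vs
zigEndL-∷ u [] p vs = refl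
zigEndL-∷ u (_ ∷ _) p vs = refl

zigEndR-∷ : ∀ v vs q us → zigEndR us (v ∷ vs ∷ʳ q) ≡ zigEndL us (vs ∷ʳ q)
zigEndR-∷ v [] q us = refl
zigEndR-∷ v (_ ∷ _) q us = refl

mutual
  zigEndL-≤ : ∀ p q us vs → length us ℕ.≤ length vs → zigEndL (us ∷ʳ p) (vs ∷ʳ q) ≡ just p
  zigEndL-≤ p q [] vs _ = refl
  zigEndL-≤ p q (u ∷ us) vs us≤vs = trans (zigEndL-∷ u us p _) (zigEndR-< p q us vs us≤vs)

  zigEndR-< : ∀ p q us vs → length us ℕ.< length vs → zigEndR (us ∷ʳ p) (vs ∷ʳ q) ≡ just p
  zigEndR-< p q us (v ∷ vs) (ℕ.s≤s us≤vs) = trans (zigEndR-∷ v vs q _) (zigEndL-≤ p q us vs us≤vs)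

mutual
  zigEndR-≤ : ∀ p q us vs → length vs ℕ.≤ length us → zigEndR (us ∷ʳ p) (vs ∷ʳ q) ≡ just q
  zigEndR-≤ p q us [] _ = refl
  zigEndR-≤ p q us (v ∷ vs) vs≤us = trans (zigEndR-∷ v vs q _) (zigEndL-< p q us vs vs≤us)

  zigEndL-< : ∀ p q us vs → length vs ℕ.< length us → zigEndL (us ∷ʳ p) (vs ∷ʳ q) ≡ just q
  zigEndL-< p q (u ∷ us) vs (ℕ.s≤s vs≤us) = trans (zigEndL-∷ u us p _) (zigEndR-≤ p q us vs vs≤us)

module _ (x y : ℤ) where

  Occupied : ℤ → Set
  Occupied j = x ≤ j × j ≤ y

  -- Without function extensionality the labeling after a walk is only known pointwise, so
  -- the rest of the run is required for every labeling taking the expected values.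
  walkL-run : ∀ n {k u τ t} → u ≡ k - + n →
    (∀ j → u < j → j ≤ k → Occupied j) → (∀ j → u < j → j ≤ k → τ j ≡ L) →
    (∀ τ' → (∀ j → u < j → j ≤ k → τ' j ≡ R) → (∀ j → j ≤ u ⊎ k < j → τ' j ≡ τ j) →
      RunPath x y τ' u (u ∷ t)) →
    RunPath x y τ k (k ∷ walkL k n ++ t)
  walkL-run zero {k} {u} {τ} {t} u≡k-0 _ _ arrive =
    subst (λ z → RunPath x y τ z (z ∷ t)) u≡k (arrive τ empty (λ _ _ → refl))
    where
    u≡k : u ≡ k
    u≡k = trans u≡k-0 (+-identityʳ k)
    empty : ∀ j → u < j → j ≤ k → τ j ≡ R
    empty j u<j j≤k = ⊥-elim (<-irrefl u≡k (<-≤-trans u<j j≤k))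
  walkL-run (suc n) {k} {u} {τ} {t} u≡k-n occ allL arrive =
    moveL (proj₁ (occ k u<k ≤-refl)) (proj₂ (occ k u<k ≤-refl)) τk≡L
      (walkL-run n u≡k-1-n (λ j u<j j≤k-1 → occ j u<j (<⇒≤ (j<k j≤k-1))) allL' arrive')
    where
    u≡k-1-n : u ≡ k - + 1 - + n
    u≡k-1-n = trans u≡k-n (i-suc[n]≡i-1-n k n)
    u<k : u < k
    u<k = ≤-<-trans (subst (_≤ k - + 1) (sym u≡k-1-n) (i-j≤i _ (+ n))) (i-1<i k)
    τk≡L : τ k ≡ L
    τk≡L = allL k u<k ≤-refl
    j<k : ∀ {j} → j ≤ k - + 1 → j < k
    j<k j≤k-1 = ≤-<-trans j≤k-1 (i-1<i k)
    allL' : ∀ j → u < j → j ≤ k - + 1 → switchAt τ k j ≡ L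
    allL' j u<j j≤k-1 = trans (switchAt-other τ (<⇒≢ (j<k j≤k-1))) (allL j u<j (<⇒≤ (j<k j≤k-1)))
    arrive' : ∀ τ' → (∀ j → u < j → j ≤ k - + 1 → τ' j ≡ R) →
      (∀ j → j ≤ u ⊎ k - + 1 < j → τ' j ≡ switchAt τ k j) → RunPath x y τ' u (u ∷ t)
    arrive' τ' flipped agree = arrive τ' flipped' agree'
      where
      flipped' : ∀ j → u < j → j ≤ k → τ' j ≡ R
      flipped' j u<j j≤k with j ℤ.≟ k
      ... | yes refl = trans (agree k (inj₂ (i-1<i k))) (trans (switchAt-self τ k) (cong switch τk≡L))
      ... | no j≢k = flipped j u<j (<⇒≤-1 (≤∧≢⇒< j≤k j≢k))
      agree' : ∀ j → j ≤ u ⊎ k < j → τ' j ≡ τ j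
      agree' j (inj₁ j≤u) =
        trans (agree j (inj₁ j≤u)) (switchAt-other τ (<⇒≢ (≤-<-trans j≤u u<k)))
      agree' j (inj₂ k<j) =
        trans (agree j (inj₂ (<-trans (i-1<i k) k<j))) (switchAt-other τ (≢-sym (<⇒≢ k<j)))

  walkR-run : ∀ n {k v τ t} → v ≡ k + + n →
    (∀ j → k ≤ j → j < v → Occupied j) → (∀ j → k ≤ j → j < v → τ j ≡ R) →
    (∀ τ' → (∀ j → k ≤ j → j < v → τ' j ≡ L) → (∀ j → j < k ⊎ v ≤ j → τ' j ≡ τ j) →
      RunPath x y τ' v (v ∷ t)) →
    RunPath x y τ k (k ∷ walkR k n ++ t)
  walkR-run zero {k} {v} {τ} {t} v≡k+0 _ _ arrive =
    subst (λ z → RunPath x y τ z (z ∷ t)) v≡k (arrive τ empty (λ _ _ → refl))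
    where
    v≡k : v ≡ k
    v≡k = trans v≡k+0 (+-identityʳ k)
    empty : ∀ j → k ≤ j → j < v → τ j ≡ L
    empty j k≤j j<v = ⊥-elim (<-irrefl (sym v≡k) (≤-<-trans k≤j j<v))
  walkR-run (suc n) {k} {v} {τ} {t} v≡k+n occ allR arrive =
    moveR (proj₁ (occ k ≤-refl k<v)) (proj₂ (occ k ≤-refl k<v)) τk≡R
      (walkR-run n v≡k+1+n (λ j k+1≤j j<v → occ j (<⇒≤ (k<j k+1≤j)) j<v) allR' arrive')
    where
    v≡k+1+n : v ≡ k + + 1 + + n
    v≡k+1+n = trans v≡k+n (i+suc[n]≡i+1+n k n)
    k<v : k < v
    k<v = <-≤-trans (i<i+1 k) (subst (k + + 1 ≤_) (sym v≡k+1+n) (i≤i+j _ (+ n)))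
    τk≡R : τ k ≡ R
    τk≡R = allR k ≤-refl k<v
    k<j : ∀ {j} → k + + 1 ≤ j → k < j
    k<j k+1≤j = <-≤-trans (i<i+1 k) k+1≤j
    allR' : ∀ j → k + + 1 ≤ j → j < v → switchAt τ k j ≡ R
    allR' j k+1≤j j<v =
      trans (switchAt-other τ (≢-sym (<⇒≢ (k<j k+1≤j)))) (allR j (<⇒≤ (k<j k+1≤j)) j<v)
    arrive' : ∀ τ' → (∀ j → k + + 1 ≤ j → j < v → τ' j ≡ L) →
      (∀ j → j < k + + 1 ⊎ v ≤ j → τ' j ≡ switchAt τ k j) → RunPath x y τ' v (v ∷ t)
    arrive' τ' flipped agree = arrive τ' flipped' agree'
      where
      flipped' : ∀ j → k ≤ j → j < v → τ' j ≡ L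
      flipped' j k≤j j<v with j ℤ.≟ k
      ... | yes refl = trans (agree k (inj₁ (i<i+1 k))) (trans (switchAt-self τ k) (cong switch τk≡R))
      ... | no j≢k = flipped j (<⇒+1≤ (≤∧≢⇒< k≤j (≢-sym j≢k))) j<v
      agree' : ∀ j → j < k ⊎ v ≤ j → τ' j ≡ τ j
      agree' j (inj₁ j<k) =
        trans (agree j (inj₁ (<-trans j<k (i<i+1 k)))) (switchAt-other τ (<⇒≢ j<k))
      agree' j (inj₂ v≤j) =
        trans (agree j (inj₂ v≤j)) (switchAt-other τ (≢-sym (<⇒≢ (<-≤-trans k<v v≤j))))

  module _ (σ : Labeling) where

    -- LeftTargets a us: us lists the paper's uᵢ below a (the R-sites in [x, a), decreasing),
    -- followed by u_{m+1} = x - 1; RightTargets b vs likewise lists the vⱼ above b.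
    data LeftTargets : ℤ → List ℤ → Set where
      exitL : ∀ {a} → x ≤ a → (∀ j → x - + 1 < j → j < a → σ j ≡ L) → LeftTargets a [ x - + 1 ]
      turnL : ∀ {a u us} → x ≤ u → u < a → σ u ≡ R → (∀ j → u < j → j < a → σ j ≡ L) →
              LeftTargets u us → LeftTargets a (u ∷ us)

    data RightTargets : ℤ → List ℤ → Set where
      exitR : ∀ {b} → b ≤ y → (∀ j → b < j → j < y + + 1 → σ j ≡ R) → RightTargets b [ y + + 1 ]
      turnR : ∀ {b v vs} → v ≤ y → b < v → σ v ≡ L → (∀ j → b < j → j < v → σ j ≡ R) →
              RightTargets v vs → RightTargets b (v ∷ vs)

    LeftTargets⇒x≤ : ∀ {a us} → LeftTargets a us → x ≤ a
    LeftTargets⇒x≤ (exitL x≤a _) = x≤a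
    LeftTargets⇒x≤ (turnL x≤u u<a _ _ _) = <⇒≤ (≤-<-trans x≤u u<a)

    RightTargets⇒≤y : ∀ {b vs} → RightTargets b vs → b ≤ y
    RightTargets⇒≤y (exitR b≤y _) = b≤y
    RightTargets⇒≤y (turnR v≤y b<v _ _ _) = <⇒≤ (<-≤-trans b<v v≤y)

    zigL-turn : ∀ {u us} p vs → LeftTargets u us → zigL p (u ∷ us) vs ≡ walkL p ∣ p - u ∣ ++ zigR u us vs
    zigL-turn p vs (exitL _ _) = refl
    zigL-turn p vs (turnL _ _ _ _ _) = refl

    zigR-turn : ∀ {v vs} p us → RightTargets v vs → zigR p us (v ∷ vs) ≡ walkR p ∣ v - p ∣ ++ zigL v us vs
    zigR-turn p us (exitR _ _) = refl
    zigR-turn p us (turnR _ _ _ _ _) = refl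

    zigEndL-turn : ∀ {u us} vs → LeftTargets u us → zigEndL (u ∷ us) vs ≡ zigEndR us vs
    zigEndL-turn vs (exitL _ _) = refl
    zigEndL-turn vs (turnL _ _ _ _ _) = refl

    zigEndR-turn : ∀ {v vs} us → RightTargets v vs → zigEndR us (v ∷ vs) ≡ zigEndL us vs
    zigEndR-turn us (exitR _ _) = refl
    zigEndR-turn us (turnR _ _ _ _ _) = refl

    record Swept (τ : Labeling) (a b : ℤ) (ℓ : Label) : Set where
      field
        inside  : ∀ j → a ≤ j → j ≤ b → τ j ≡ ℓ
        outside : ∀ j → j < a ⊎ b < j → τ j ≡ σ j

    swept-origin : ∀ {ℓ} → σ (+ 0) ≡ ℓ → Swept σ (+ 0) (+ 0) ℓ
    swept-origin {ℓ} σ0≡ℓ = record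
      { inside = λ j 0≤j j≤0 → subst (λ k → σ k ≡ ℓ) (≤-antisym 0≤j j≤0) σ0≡ℓ
      ; outside = λ _ _ → refl }

    sweepL : ∀ {a b u τ t} → x - + 1 ≤ u → u < a → a ≤ b → b ≤ y →
      (∀ j → u < j → j < a → σ j ≡ L) → Swept τ a b L →
      (∀ τ' → (∀ j → u < j → j ≤ b → τ' j ≡ R) → (∀ j → j ≤ u ⊎ b < j → τ' j ≡ σ j) →
        RunPath x y τ' u (u ∷ t)) →
      RunPath x y τ b (b ∷ walkL b ∣ b - u ∣ ++ t)
    sweepL {a} {b} {u} {τ} x-1≤u u<a a≤b b≤y gap sw arrive =
      walkL-run _ (sym (j≤i⇒i-∣i-j∣≡j (<⇒≤ (<-≤-trans u<a a≤b)))) occ allL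
        (λ τ' flipped agree → arrive τ' flipped (λ j j∉ → trans (agree j j∉) (untouched j j∉)))
      where
      occ : ∀ j → u < j → j ≤ b → Occupied j
      occ j u<j j≤b = -1<⇒≤ (≤-<-trans x-1≤u u<j) , ≤-trans j≤b b≤y
      allL : ∀ j → u < j → j ≤ b → τ j ≡ L
      allL j u<j j≤b with ≤⊎> a j
      ... | inj₁ a≤j = Swept.inside sw j a≤j j≤b
      ... | inj₂ j<a = trans (Swept.outside sw j (inj₁ j<a)) (gap j u<j j<a)
      untouched : ∀ j → j ≤ u ⊎ b < j → τ j ≡ σ j
      untouched j (inj₁ j≤u) = Swept.outside sw j (inj₁ (≤-<-trans j≤u u<a))
      untouched j (inj₂ b<j) = Swept.outside sw j (inj₂ b<j)

    sweepR : ∀ {a b v τ t} → v ≤ y + + 1 → b < v → a ≤ b → x ≤ a →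
      (∀ j → b < j → j < v → σ j ≡ R) → Swept τ a b R →
      (∀ τ' → (∀ j → a ≤ j → j < v → τ' j ≡ L) → (∀ j → j < a ⊎ v ≤ j → τ' j ≡ σ j) →
        RunPath x y τ' v (v ∷ t)) →
      RunPath x y τ a (a ∷ walkR a ∣ v - a ∣ ++ t)
    sweepR {a} {b} {v} {τ} v≤y+1 b<v a≤b x≤a gap sw arrive =
      walkR-run _ (sym (i≤j⇒i+∣j-i∣≡j (<⇒≤ (≤-<-trans a≤b b<v)))) occ allR
        (λ τ' flipped agree → arrive τ' flipped (λ j j∉ → trans (agree j j∉) (untouched j j∉)))
      where
      occ : ∀ j → a ≤ j → j < v → Occupied j
      occ j a≤j j<v = ≤-trans x≤a a≤j , <+1⇒≤ (<-≤-trans j<v v≤y+1)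
      allR : ∀ j → a ≤ j → j < v → τ j ≡ R
      allR j a≤j j<v with ≤⊎> j b
      ... | inj₁ j≤b = Swept.inside sw j a≤j j≤b
      ... | inj₂ b<j = trans (Swept.outside sw j (inj₂ b<j)) (gap j b<j j<v)
      untouched : ∀ j → j < a ⊎ v ≤ j → τ j ≡ σ j
      untouched j (inj₁ j<a) = Swept.outside sw j (inj₁ j<a)
      untouched j (inj₂ v≤j) = Swept.outside sw j (inj₂ (<-≤-trans b<v v≤j))

    sweptR-at-turn : ∀ {u b τ} → σ u ≡ R →
      (∀ j → u < j → j ≤ b → τ j ≡ R) → (∀ j → j ≤ u ⊎ b < j → τ j ≡ σ j) → Swept τ u b R
    sweptR-at-turn {u} {b} {τ} σu≡R flipped agree = record { inside = inside ; outside = outside }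
      where
      inside : ∀ j → u ≤ j → j ≤ b → τ j ≡ R
      inside j u≤j j≤b with u ℤ.≟ j
      ... | yes refl = trans (agree u (inj₁ ≤-refl)) σu≡R
      ... | no u≢j = flipped j (≤∧≢⇒< u≤j u≢j) j≤b
      outside : ∀ j → j < u ⊎ b < j → τ j ≡ σ j
      outside j (inj₁ j<u) = agree j (inj₁ (<⇒≤ j<u))
      outside j (inj₂ b<j) = agree j (inj₂ b<j)

    sweptL-at-turn : ∀ {a v τ} → σ v ≡ L →
      (∀ j → a ≤ j → j < v → τ j ≡ L) → (∀ j → j < a ⊎ v ≤ j → τ j ≡ σ j) → Swept τ a v L
    sweptL-at-turn {a} {v} {τ} σv≡L flipped agree = record { inside = inside ; outside = outside }
      where
      inside : ∀ j → a ≤ j → j ≤ v → τ j ≡ L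
      inside j a≤j j≤v with j ℤ.≟ v
      ... | yes refl = trans (agree v (inj₂ ≤-refl)) σv≡L
      ... | no j≢v = flipped j a≤j (≤∧≢⇒< j≤v j≢v)
      outside : ∀ j → j < a ⊎ v < j → τ j ≡ σ j
      outside j (inj₁ j<a) = agree j (inj₁ j<a)
      outside j (inj₂ v<j) = agree j (inj₂ (<⇒≤ v<j))

    mutual
      runL : ∀ {a b τ us vs} → a ≤ b → Swept τ a b L → LeftTargets a us → RightTargets b vs →
        RunPath x y τ b (b ∷ zigL b us vs)
      runL {b = b} {τ} a≤b sw (exitL x≤a gap) V =
        subst (λ p → RunPath x y τ b (b ∷ p)) (++-identityʳ _)
          (sweepL ≤-refl (<-≤-trans (i-1<i x) x≤a) a≤b (RightTargets⇒≤y V) gap sw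
            (λ _ _ _ → stop (inj₁ (i-1<i x))))
      runL {b = b} {vs = vs} a≤b sw (turnL x≤u u<a σu≡R gap U) V rewrite zigL-turn b vs U =
        sweepL (≤-trans (<⇒≤ (i-1<i x)) x≤u) u<a a≤b (RightTargets⇒≤y V) gap sw
          (λ τ' flipped agree →
            runR (<⇒≤ (<-≤-trans u<a a≤b)) (sweptR-at-turn σu≡R flipped agree) U V)

      runR : ∀ {a b τ us vs} → a ≤ b → Swept τ a b R → LeftTargets a us → RightTargets b vs →
        RunPath x y τ a (a ∷ zigR a us vs)
      runR {a} {τ = τ} a≤b sw U (exitR b≤y gap) =
        subst (λ p → RunPath x y τ a (a ∷ p)) (++-identityʳ _)
          (sweepR ≤-refl (≤-<-trans b≤y (i<i+1 y)) a≤b (LeftTargets⇒x≤ U) gap sw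
            (λ _ _ _ → stop (inj₂ (i<i+1 y))))
      runR {a} {us = us} a≤b sw U (turnR v≤y b<v σv≡L gap V) rewrite zigR-turn a us V =
        sweepR (<⇒≤ (≤-<-trans v≤y (i<i+1 y))) b<v a≤b (LeftTargets⇒x≤ U) gap sw
          (λ τ' flipped agree →
            runL (<⇒≤ (≤-<-trans a≤b b<v)) (sweptL-at-turn σv≡L flipped agree) U V)

    mutual
      last-zigL : ∀ {a b us vs} → a ≤ b → LeftTargets a us → RightTargets b vs →
        last (b ∷ zigL b us vs) ≡ zigEndL us vs
      last-zigL {b = b} a≤b (exitL x≤a _) _ =
        trans (last-walkL b _) (cong just (j≤i⇒i-∣i-j∣≡j (<⇒≤ (<-≤-trans (i-1<i x) (≤-trans x≤a a≤b)))))
      last-zigL {b = b} {u ∷ us} {vs} a≤b (turnL _ u<a _ _ U) V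
        rewrite zigL-turn b vs U | zigEndL-turn vs U =
        trans (last-++ b (walkL b ∣ b - u ∣) (zigR u us vs)
                (trans (last-walkL b _) (cong just (j≤i⇒i-∣i-j∣≡j u≤b))))
              (last-zigR u≤b U V)
        where
        u≤b : u ≤ b
        u≤b = <⇒≤ (<-≤-trans u<a a≤b)

      last-zigR : ∀ {a b us vs} → a ≤ b → LeftTargets a us → RightTargets b vs →
        last (a ∷ zigR a us vs) ≡ zigEndR us vs
      last-zigR {a} a≤b _ (exitR b≤y _) =
        trans (last-walkR a _) (cong just (i≤j⇒i+∣j-i∣≡j (<⇒≤ (≤-<-trans (≤-trans a≤b b≤y) (i<i+1 y)))))
      last-zigR {a} {us = us} {v ∷ vs} a≤b U (turnR _ b<v _ _ V)
        rewrite zigR-turn a us V | zigEndR-turn us V =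
        trans (last-++ a (walkR a ∣ v - a ∣) (zigL v us vs)
                (trans (last-walkR a _) (cong just (i≤j⇒i+∣j-i∣≡j a≤v))))
              (last-zigL a≤v U V)
        where
        a≤v : a ≤ v
        a≤v = <⇒≤ (≤-<-trans a≤b b<v)

    extendL : ∀ {c a us} → LeftTargets c us → c < a → (∀ j → c ≤ j → j < a → σ j ≡ L) →
      LeftTargets a us
    extendL {c} {a} (exitL x≤c gap) c<a allL = exitL (<⇒≤ (≤-<-trans x≤c c<a)) gap'
      where
      gap' : ∀ j → x - + 1 < j → j < a → σ j ≡ L
      gap' j x-1<j j<a with ≤⊎> c j
      ... | inj₁ c≤j = allL j c≤j j<a
      ... | inj₂ j<c = gap j x-1<j j<c
    extendL {c} {a} (turnL {u = u} x≤u u<c σu≡R gap U) c<a allL = turnL x≤u (<-trans u<c c<a) σu≡R gap' U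
      where
      gap' : ∀ j → u < j → j < a → σ j ≡ L
      gap' j u<j j<a with ≤⊎> c j
      ... | inj₁ c≤j = allL j c≤j j<a
      ... | inj₂ j<c = gap j u<j j<c

    extendR : ∀ {b c vs} → RightTargets c vs → b < c → (∀ j → b < j → j ≤ c → σ j ≡ R) →
      RightTargets b vs
    extendR {b} {c} (exitR c≤y gap) b<c allR = exitR (<⇒≤ (<-≤-trans b<c c≤y)) gap'
      where
      gap' : ∀ j → b < j → j < y + + 1 → σ j ≡ R
      gap' j b<j j<y+1 with ≤⊎> j c
      ... | inj₁ j≤c = allR j b<j j≤c
      ... | inj₂ c<j = gap j c<j j<y+1
    extendR {b} {c} (turnR {v = v} v≤y c<v σv≡L gap V) b<c allR = turnR v≤y (<-trans b<c c<v) σv≡L gap' V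
      where
      gap' : ∀ j → b < j → j < v → σ j ≡ R
      gap' j b<j j<v with ≤⊎> j c
      ... | inj₁ j≤c = allR j b<j j≤c
      ... | inj₂ c<j = gap j c<j j<v

    prependL : ∀ {a u} xs t → x ≤ u → u ≡ a - + 1 →
      LeftTargets u (filter (λ k → σ k ≟L R) xs ++ t) →
      LeftTargets a (filter (λ k → σ k ≟L R) (u ∷ xs) ++ t)
    prependL {a} xs t x≤a-1 refl U with σ (a - + 1) ≟L R
    ... | yes σa-1≡R =
      turnL x≤a-1 (i-1<i a) σa-1≡R (λ j a-1<j j<a → ⊥-elim (<⇒≱ a-1<j (<⇒≤-1 j<a))) U
    ... | no σa-1≢R = extendL U (i-1<i a) λ j a-1≤j j<a →
      subst (λ k → σ k ≡ L) (≤-antisym a-1≤j (<⇒≤-1 j<a)) (≢R⇒≡L σa-1≢R)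

    prependR : ∀ {b v} xs t → v ≤ y → v ≡ b + + 1 →
      RightTargets v (filter (λ k → σ k ≟L L) xs ++ t) →
      RightTargets b (filter (λ k → σ k ≟L L) (v ∷ xs) ++ t)
    prependR {b} xs t b+1≤y refl V with σ (b + + 1) ≟L L
    ... | yes σb+1≡L =
      turnR b+1≤y (i<i+1 b) σb+1≡L (λ j b<j j<b+1 → ⊥-elim (<⇒≱ j<b+1 (<⇒+1≤ b<j))) V
    ... | no σb+1≢L = extendR V (i<i+1 b) λ j b<j j≤b+1 →
      subst (λ k → σ k ≡ R) (≤-antisym (<⇒+1≤ b<j) j≤b+1) (≢L⇒≡R σb+1≢L)

    filter-leftTargets : ∀ n a (g : ℕ → ℤ) → (∀ i → g i ≡ a - + suc i) → x ≡ a - + n →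
      LeftTargets a (filter (λ k → σ k ≟L R) (applyUpTo g n) ++ [ x - + 1 ])
    filter-leftTargets zero a g _ x≡a-0 = exitL (≤-reflexive x≡a) λ j x-1<j j<a →
      ⊥-elim (<⇒≱ j<a (subst (_≤ j) x≡a (-1<⇒≤ x-1<j)))
      where
      x≡a : x ≡ a
      x≡a = trans x≡a-0 (+-identityʳ a)
    filter-leftTargets (suc n) a g g≡ x≡a-n =
      prependL (applyUpTo (g ∘ suc) n) _ (subst (_≤ g 0) (sym x≡g0-n) (i-j≤i _ (+ n))) (g≡ 0)
        (filter-leftTargets n (g 0) (g ∘ suc) g∘suc≡ x≡g0-n)
      where
      a-1≡g0 : a - + 1 ≡ g 0
      a-1≡g0 = sym (g≡ 0)
      x≡g0-n : x ≡ g 0 - + n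
      x≡g0-n = trans x≡a-n (trans (i-suc[n]≡i-1-n a n) (cong (_- + n) a-1≡g0))
      g∘suc≡ : ∀ i → g (suc i) ≡ g 0 - + suc i
      g∘suc≡ i = trans (g≡ (suc i)) (trans (i-suc[n]≡i-1-n a (suc i)) (cong (_- + suc i) a-1≡g0))

    filter-rightTargets : ∀ n b (g : ℕ → ℤ) → (∀ i → g i ≡ b + + suc i) → y ≡ b + + n →
      RightTargets b (filter (λ k → σ k ≟L L) (applyUpTo g n) ++ [ y + + 1 ])
    filter-rightTargets zero b g _ y≡b+0 = exitR (≤-reflexive (sym y≡b)) λ j b<j j<y+1 →
      ⊥-elim (<⇒≱ b<j (subst (j ≤_) y≡b (<+1⇒≤ j<y+1)))
      where
      y≡b : y ≡ b
      y≡b = trans y≡b+0 (+-identityʳ b)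
    filter-rightTargets (suc n) b g g≡ y≡b+n =
      prependR (applyUpTo (g ∘ suc) n) _ (subst (g 0 ≤_) (sym y≡g0+n) (i≤i+j _ (+ n))) (g≡ 0)
        (filter-rightTargets n (g 0) (g ∘ suc) g∘suc≡ y≡g0+n)
      where
      b+1≡g0 : b + + 1 ≡ g 0
      b+1≡g0 = sym (g≡ 0)
      y≡g0+n : y ≡ g 0 + + n
      y≡g0+n = trans y≡b+n (trans (i+suc[n]≡i+1+n b n) (cong (_+ + n) b+1≡g0))
      g∘suc≡ : ∀ i → g (suc i) ≡ g 0 + + suc i
      g∘suc≡ i = trans (g≡ (suc i)) (trans (i+suc[n]≡i+1+n b (suc i)) (cong (_+ + suc i) b+1≡g0))

    leftRs-targets : x ≤ + 0 → LeftTargets (+ 0) (leftRs x σ ++ [ x - + 1 ])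
    leftRs-targets x≤0 =
      subst (λ us → LeftTargets (+ 0) (filter (λ k → σ k ≟L R) us ++ [ x - + 1 ]))
        (sym (map-upTo -[1+_] ∣ x ∣))
        (filter-leftTargets ∣ x ∣ (+ 0) -[1+_] (λ _ → refl) (sym (i≤0⇒0-∣i∣≡i x≤0)))

    rightLs-targets : + 0 ≤ y → RightTargets (+ 0) (rightLs y σ ++ [ y + + 1 ])
    rightLs-targets 0≤y =
      subst (λ vs → RightTargets (+ 0) (filter (λ k → σ k ≟L L) vs ++ [ y + + 1 ]))
        (sym (map-upTo (+_ ∘ suc) ∣ y ∣))
        (filter-rightTargets ∣ y ∣ (+ 0) (+_ ∘ suc) (λ _ → refl) (sym (0≤i⇒0+∣i∣≡i 0≤y)))

-- r and s only govern how the occupied interval grows once the particle has stopped.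
lemma2p2 : (r s : ℕ) → 0 ℕ.< r → 0 ℕ.< s →
    (x y : ℤ) → x ≤ + 0 → + 0 ≤ y → (σ : Labeling) →
    RunPath x y σ (+ 0) (zigzagPath x y σ)
    × (length (leftRs x σ) ℕ.< length (rightLs y σ) → last (zigzagPath x y σ) ≡ just (x - + 1))
    × (length (rightLs y σ) ℕ.< length (leftRs x σ) → last (zigzagPath x y σ) ≡ just (y + + 1))
    × (length (leftRs x σ) ≡ length (rightLs y σ) → σ (+ 0) ≡ L → last (zigzagPath x y σ) ≡ just (x - + 1))
    × (length (leftRs x σ) ≡ length (rightLs y σ) → σ (+ 0) ≡ R → last (zigzagPath x y σ) ≡ just (y + + 1))
lemma2p2 _ _ _ _ x y x≤0 0≤y σ
  with σ (+ 0) in σ0 | leftRs-targets x y σ x≤0 | rightLs-targets x y σ 0≤y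
... | L | U | V =
  let end = last-zigL x y σ ≤-refl U V in
    runL x y σ ≤-refl (swept-origin x y σ σ0) U V
  , (λ m<n → trans end (zigEndL-≤ _ _ (leftRs x σ) (rightLs y σ) (ℕ.<⇒≤ m<n)))
  , (λ n<m → trans end (zigEndL-< _ _ (leftRs x σ) (rightLs y σ) n<m))
  , (λ m≡n _ → trans end (zigEndL-≤ _ _ (leftRs x σ) (rightLs y σ) (ℕ.≤-reflexive m≡n)))
  , (λ _ ())
... | R | U | V =
  let end = last-zigR x y σ ≤-refl U V in
    runR x y σ ≤-refl (swept-origin x y σ σ0) U V
  , (λ m<n → trans end (zigEndR-< _ _ (leftRs x σ) (rightLs y σ) m<n))
  , (λ n<m → trans end (zigEndR-≤ _ _ (leftRs x σ) (rightLs y σ) (ℕ.<⇒≤ n<m)))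
  , (λ _ ())
  , (λ m≡n _ → trans end (zigEndR-≤ _ _ (leftRs x σ) (rightLs y σ) (ℕ.≤-reflexive (sym m≡n))))
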